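{- Let $\mathbf{v}=(v_1,\dots,v_m)$ and $\mathbf{k}=(k_1,\dots,k_m)$ be $m$-tuples of positive integers with $\mathbf{v}\ge\mathbf{k}$, let $X_1,\dots,X_m$ be pairwise disjoint sets with $|X_i|=v_i$, and let $1\le t\le m$. Let $i_1,\dots,i_t$ be distinct elements of $\{1,\dots,m\}$, and let $\mathcal{C}$ be a collection of $m$-tuples $(B_1,\dots,B_m)$ with $B_i\subseteq X_i$, $|B_i|=k_i$, such that for every choice of elements $x_{i_1}\in X_{i_1},\dots,x_{i_t}\in X_{i_t}$ there is a member $(B_1,\dots,B_m)\in\mathcal{C}$ with $x_{i_j}\in B_{i_j}$ for all $j=1,\dots,t$. Then \[ |\mathcal{C}|\ge \left\lceil \frac{v_{i_1}}{k_{i_1}}\left\lceil\frac{v_{i_2}}{k_{i_2}}\cdots\left\lceil\frac{v_{i_t}}{k_{i_t}}\right\rceil\cdots\right\rceil\right\rceil. \]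
   Context: $\mathbf{v}\ge\mathbf{k}$ means $v_i\ge k_i$ for all $i$. -}

module Defs where

open import Data.Nat using (ℕ; zero; suc; _+_; _*_)
open import Data.Nat.DivMod using (_/_)
open import Data.Fin using (Fin; zero; suc)
open import Function using (_∘_)

-- ⌈ a / b ⌉ for b > 0 (junk value 0 when b = 0; never used since all k_i ≥ 1)
ceilDiv : ℕ → ℕ → ℕ
ceilDiv a zero    = 0
ceilDiv a (suc b) = (a + b) / suc b

-- nestedBound v k idx  =  ⌈ v_{i_1}/k_{i_1} ⌈ v_{i_2}/k_{i_2} ⋯ ⌈ v_{i_t}/k_{i_t} ⌉ ⋯ ⌉ ⌉
-- where idx j = i_{j+1}.  (For t = 0 the empty product is 1.)
nestedBound : ∀ {m t} → (Fin m → ℕ) → (Fin m → ℕ) → (Fin t → Fin m) → ℕ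
nestedBound {t = zero}  v k idx = 1
nestedBound {t = suc t} v k idx =
  ceilDiv (v (idx zero) * nestedBound v k (idx ∘ suc)) (k (idx zero))

-- Double counting. If a subfamily S covers every tuple over the indices
-- i₁,…,i_t, then for each y ∈ X_{i₁} the members of S whose i₁-block contains y
-- cover every tuple over i₂,…,i_t, so by induction there are at least
-- N' = ⌈v_{i₂}/k_{i₂} ⌈⋯⌉⌉ of them. Summing over the v_{i₁} choices of y counts
-- each member of S at most k_{i₁} times, hence v_{i₁} N' ≤ k_{i₁} |S|, which is
-- the outermost ceiling.
module Submission where

open import Defs
open import Data.Nat using (ℕ; _≤_; _≥_)
open import Data.Fin using (Fin)
open import Data.Fin.Subset using (Subset; _∈_; ∣_∣)
open import Data.Product using (∃)
open import Relation.Binary.PropositionalEquality using (_≡_)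
open import Function.Definitions using (Injective)

open import Data.Nat using (zero; suc; _+_; _*_; z≤n; s≤s; s≤s⁻¹)
open import Data.Nat.Properties
open import Data.Nat.DivMod using (m<n*o⇒m/o<n)
open import Data.Fin using (zero; suc)
open import Data.Bool using (Bool; true; false; _∧_)
open import Data.Vec using ([]; _∷_; lookup)
open import Data.Vec.Properties using ([]=⇒lookup)
open import Data.Product using (_,_; _×_)
open import Relation.Binary.PropositionalEquality using (refl; sym; trans; cong; module ≡-Reasoning)
open import Function using (_∘_)
open import Algebra.Properties.Semiring.Sum +-*-semiring
  using (sum; sum-syntax; sum-cong-≗; ∑-comm; *-distribˡ-sum; *-distribʳ-sum)

χ : Bool → ℕ
χ true  = 1
χ false = 0

count : ∀ {n} → (Fin n → Bool) → ℕ
count {n} p = ∑[ i < n ] χ (p i)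

sum-mono-≤ : ∀ {n} {f g : Fin n → ℕ} → (∀ i → f i ≤ g i) → sum f ≤ sum g
sum-mono-≤ {zero}  f≤g = z≤n
sum-mono-≤ {suc n} f≤g = +-mono-≤ (f≤g zero) (sum-mono-≤ (f≤g ∘ suc))

sum-const : ∀ n x → ∑[ i < n ] x ≡ n * x
sum-const zero    x = refl
sum-const (suc n) x = cong (x +_) (sum-const n x)

χ-∧ : ∀ a b → χ (a ∧ b) ≡ χ a * χ b
χ-∧ true  b = sym (+-identityʳ (χ b))
χ-∧ false b = refl

count-all : ∀ n → count {n} (λ _ → true) ≡ n
count-all n = trans (sum-const n 1) (*-identityʳ n)

true⇒1≤count : ∀ {n} (p : Fin n → Bool) a → p a ≡ true → 1 ≤ count p
true⇒1≤count p zero    pa≡true rewrite pa≡true = s≤s z≤n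
true⇒1≤count p (suc a) pa≡true =
  ≤-trans (true⇒1≤count (p ∘ suc) a pa≡true) (m≤n+m _ (χ (p zero)))

count-lookup : ∀ {n} (p : Subset n) → count (lookup p) ≡ ∣ p ∣
count-lookup []          = refl
count-lookup (true  ∷ p) = cong suc (count-lookup p)
count-lookup (false ∷ p) = count-lookup p

ceilDiv-least : ∀ a s k → a ≤ s * k → ceilDiv a k ≤ s
ceilDiv-least a s zero    _ = z≤n
ceilDiv-least a s (suc k) a≤sk = s≤s⁻¹ (m<n*o⇒m/o<n (s≤s a+k≤k+sk))
  where
  a+k≤k+sk : a + k ≤ k + s * suc k
  a+k≤k+sk = ≤-trans (+-monoˡ-≤ k a≤sk) (≤-reflexive (+-comm (s * suc k) k))

∑-count-∧ : ∀ {c n} (S : Fin c → Bool) (B : Fin c → Fin n → Bool) →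
  ∑[ y < n ] count (λ a → S a ∧ B a y) ≡ ∑[ a < c ] (χ (S a) * count (B a))
∑-count-∧ {c} {n} S B = begin
  ∑[ y < n ] ∑[ a < c ] χ (S a ∧ B a y)       ≡⟨ ∑-comm (λ y a → χ (S a ∧ B a y)) ⟩
  ∑[ a < c ] ∑[ y < n ] χ (S a ∧ B a y)       ≡⟨ sum-cong-≗ (λ a → sum-cong-≗ (λ y → χ-∧ (S a) (B a y))) ⟩
  ∑[ a < c ] ∑[ y < n ] (χ (S a) * χ (B a y)) ≡⟨ sum-cong-≗ (λ a → sym (*-distribˡ-sum (χ (S a)) (χ ∘ B a))) ⟩
  ∑[ a < c ] (χ (S a) * count (B a))          ∎
  where open ≡-Reasoning

module _ {m c} {v : Fin m → ℕ} (C : Fin c → (i : Fin m) → Fin (v i) → Bool) where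

  Covers : ∀ {t} → (Fin t → Fin m) → (Fin c → Bool) → Set
  Covers idx S = ∀ (x : ∀ j → Fin (v (idx j))) →
    ∃ λ a → S a ≡ true × (∀ j → C a (idx j) (x j) ≡ true)

  Covers-tail : ∀ {t} (idx : Fin (suc t) → Fin m) {S} → Covers idx S →
    ∀ y → Covers (idx ∘ suc) (λ a → S a ∧ C a (idx zero) y)
  Covers-tail idx {S} cov y x with cov (λ { zero → y ; (suc j) → x j })
  ... | a , Sa≡true , x∈C = a , Sa∧y∈C , x∈C ∘ suc
    where
    Sa∧y∈C : S a ∧ C a (idx zero) y ≡ true
    Sa∧y∈C rewrite Sa≡true = x∈C zero

module _ {m c} {v : Fin m → ℕ} (k : Fin m → ℕ) (C : Fin c → (i : Fin m) → Fin (v i) → Bool)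
         (C-size : ∀ a i → count (C a i) ≤ k i) where

  ∑-count-∧≤ : ∀ i (S : Fin c → Bool) →
    ∑[ y < v i ] count (λ a → S a ∧ C a i y) ≤ count S * k i
  ∑-count-∧≤ i S = begin
    ∑[ y < v i ] count (λ a → S a ∧ C a i y) ≡⟨ ∑-count-∧ S (λ a → C a i) ⟩
    ∑[ a < c ] (χ (S a) * count (C a i))     ≤⟨ sum-mono-≤ (λ a → *-monoʳ-≤ (χ (S a)) (C-size a i)) ⟩
    ∑[ a < c ] (χ (S a) * k i)               ≡⟨ sym (*-distribʳ-sum (k i) (χ ∘ S)) ⟩
    count S * k i                            ∎
    where open ≤-Reasoning

  nestedBound≤count : ∀ {t} (idx : Fin t → Fin m) (S : Fin c → Bool) →
    Covers C idx S → nestedBound v k idx ≤ count S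
  nestedBound≤count {zero} idx S cov with cov (λ ())
  ... | a , Sa≡true , _ = true⇒1≤count S a Sa≡true
  nestedBound≤count {suc t} idx S cov = ceilDiv-least _ _ _ (begin
    v i * N'                                 ≡⟨ sym (sum-const (v i) N') ⟩
    ∑[ y < v i ] N'                          ≤⟨ sum-mono-≤ (λ y → nestedBound≤count (idx ∘ suc) _ (Covers-tail C idx cov y)) ⟩
    ∑[ y < v i ] count (λ a → S a ∧ C a i y) ≤⟨ ∑-count-∧≤ i S ⟩
    count S * k i                            ∎)
    where
    open ≤-Reasoning
    i : Fin m
    i = idx zero
    N' : ℕ
    N' = nestedBound v k (idx ∘ suc)

proposition5p1 : (m : ℕ) (v k : Fin m → ℕ) →
    (∀ i → 1 ≤ k i) → (∀ i → k i ≤ v i) →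
    (t : ℕ) → 1 ≤ t → t ≤ m →
    (idx : Fin t → Fin m) → Injective _≡_ _≡_ idx →
    (c : ℕ) (C : Fin c → (i : Fin m) → Subset (v i)) →
    (∀ a i → ∣ C a i ∣ ≡ k i) →
    (∀ (x : (j : Fin t) → Fin (v (idx j))) →
       ∃ λ a → ∀ j → x j ∈ C a (idx j)) →
    c ≥ nestedBound v k idx
proposition5p1 m v k _ _ t _ _ idx _ c C size cov = begin
  nestedBound v k idx    ≤⟨ nestedBound≤count k C′ size′ idx (λ _ → true) cov′ ⟩
  count {c} (λ _ → true) ≡⟨ count-all c ⟩
  c                      ∎
  where
  open ≤-Reasoning
  C′ : Fin c → (i : Fin m) → Fin (v i) → Bool
  C′ a i = lookup (C a i)
  size′ : ∀ a i → count (C′ a i) ≤ k i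
  size′ a i = ≤-reflexive (trans (count-lookup (C a i)) (size a i))
  cov′ : Covers C′ idx (λ _ → true)
  cov′ x with cov x
  ... | a , x∈C = a , refl , []=⇒lookup ∘ x∈C
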